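{- For every closed formula $A$: if $\mathsf{m}\ell\mathsf{IKt}2\vdash A$ then $\ell\mathsf{IKt}2\vdash A$; and if $\mathsf{m}\ell\mathsf{IKt}2\setminus\mathsf{cut}\vdash A$ then $\ell\mathsf{IKt}2\setminus\mathsf{cut}\vdash A$.
   Context: Formulas: $A ::= P \mid X \mid A\to B \mid \Box A \mid \blacksquare A \mid \forall X A$ over propositional symbols $P$ and second-order variables $X$; $A[C/X]$ capture-avoiding substitution. Labelled sequents: world symbols; relational atoms $vRw$; labelled formulas $v:A$ ($A$ closed); sequents $\mathcal R\mid\Gamma\Rightarrow\Delta$ with $\mathcal R$ a set of relational atoms and $\Gamma,\Delta$ multisets of labelled formulas. $\ell\mathsf{Kt}2$ rules (fresh = not in the conclusion): id: $\mathcal R\mid v:A\Rightarrow v:A$; cut: from $\mathcal R\mid\Gamma\Rightarrow\Delta,v:A$ and $\mathcal R\mid\Gamma',v:A\Rightarrow\Delta'$ infer $\mathcal R\mid\Gamma,\Gamma'\Rightarrow\Delta,\Delta'$; weakening and contraction both sides; $\to$L: from $\mathcal R\mid\Gamma\Rightarrow\Delta,v:A$ and $\mathcal R\mid\Gamma',v:B\Rightarrow\Delta'$ infer $\mathcal R\mid\Gamma,\Gamma',v:A\to B\Rightarrow\Delta,\Delta'$; $\to$R: from $\mathcal R\mid\Gamma,v:A\Rightarrow\Delta,v:B$ infer $\mathcal R\mid\Gamma\Rightarrow\Delta,v:A\to B$; $\forall$L: from $\mathcal R\mid\Gamma,v:A[C/X]\Rightarrow\Delta$ infer $\mathcal R\mid\Gamma,v:\forall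 XA\Rightarrow\Delta$; $\forall$R: from $\mathcal R\mid\Gamma\Rightarrow\Delta,v:A[P/X]$ infer $\mathcal R\mid\Gamma\Rightarrow\Delta,v:\forall XA$, $P$ fresh; $\Box$L: from $\mathcal R,vRw\mid\Gamma,w:A\Rightarrow\Delta$ infer $\mathcal R,vRw\mid\Gamma,v:\Box A\Rightarrow\Delta$; $\Box$R: from $\mathcal R,vRw\mid\Gamma\Rightarrow\Delta,w:A$ infer $\mathcal R\mid\Gamma\Rightarrow\Delta,v:\Box A$, $w$ fresh; $\blacksquare$L: from $\mathcal R,uRv\mid\Gamma,u:A\Rightarrow\Delta$ infer $\mathcal R,uRv\mid\Gamma,v:\blacksquare A\Rightarrow\Delta$; $\blacksquare$R: from $\mathcal R,uRv\mid\Gamma\Rightarrow\Delta,u:A$ infer $\mathcal R\mid\Gamma\Rightarrow\Delta,v:\blacksquare A$, $u$ fresh. $\ell\mathsf{IKt}2$: restriction to sequents with singleton right-hand side. $\mathsf{m}\ell\mathsf{IKt}2$: restriction in which every right logical step ($\to$R, $\forall$R, $\Box$R, $\blacksquare$R) has $\Delta=\emptyset$. $\mathsf L\setminus\mathsf{cut}$: $\mathsf L$ without cut. $\mathsf L\vdash A$ means $\mathsf L$ proves $\emptyset\mid\emptyset\Rightarrow v:A$. -}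

module Defs where

open import Data.Nat using (ℕ; suc)
open import Data.Fin using (Fin; zero; suc)
open import Data.Bool using (Bool; true)
open import Data.List using (List; []; _∷_; _++_; length; concatMap)
open import Data.List.Membership.Propositional using (_∈_; _∉_)
open import Data.List.Relation.Binary.Permutation.Propositional using (_↭_)
open import Data.Product using (_×_; _,_; proj₁; proj₂)
open import Data.Unit using (⊤)
open import Relation.Binary.PropositionalEquality using (_≡_)

-- Formulas (second-order variables as de Bruijn indices; Fm n = formulas
-- with at most n free second-order variables; closed formulas = Fm 0).
-- Propositional symbols are natural numbers.

data Fm (n : ℕ) : Set where
  prop : ℕ → Fm n
  var  : Fin n → Fm n
  _⇒_  : Fm n → Fm n → Fm n
  □    : Fm n → Fm n
  ■    : Fm n → Fm n
  ∀'   : Fm (suc n) → Fm n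

infixr 5 _⇒_

ren : ∀ {m n} → (Fin m → Fin n) → Fm m → Fm n
ren ρ (prop p) = prop p
ren ρ (var x)  = var (ρ x)
ren ρ (A ⇒ B)  = ren ρ A ⇒ ren ρ B
ren ρ (□ A)    = □ (ren ρ A)
ren ρ (■ A)    = ■ (ren ρ A)
ren ρ (∀' A)   = ∀' (ren ext A)
  where
  ext : Fin (suc _) → Fin (suc _)
  ext zero    = zero
  ext (suc i) = suc (ρ i)

sub : ∀ {m n} → (Fin m → Fm n) → Fm m → Fm n
sub σ (prop p) = prop p
sub σ (var x)  = σ x
sub σ (A ⇒ B)  = sub σ A ⇒ sub σ B
sub σ (□ A)    = □ (sub σ A)
sub σ (■ A)    = ■ (sub σ A)
sub σ (∀' A)   = ∀' (sub ext A)
  where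
  ext : Fin (suc _) → Fm (suc _)
  ext zero    = var zero
  ext (suc i) = ren suc (σ i)

-- A[C/X] for the body A of ∀X A (X = de Bruijn index 0), C closed.
_[_] : Fm 1 → Fm 0 → Fm 0
A [ C ] = sub (λ _ → C) A

props : ∀ {n} → Fm n → List ℕ
props (prop p) = p ∷ []
props (var x)  = []
props (A ⇒ B)  = props A ++ props B
props (□ A)    = props A
props (■ A)    = props A
props (∀' A)   = props A

World : Set
World = ℕ

RelAtom : Set               -- (v , w) stands for vRw
RelAtom = World × World

LFm : Set                   -- (v , A) stands for v : A, A closed
LFm = World × Fm 0

record Seq : Set where
  constructor ⟨_∣_⇒_⟩
  field
    rel : List RelAtom      -- a set, represented by a list (see SetEq)
    ant : List LFm          -- multiset, represented by a list (see _↭_)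
    sucd : List LFm

open Seq public

SetEq : List RelAtom → List RelAtom → Set
SetEq R R' = (∀ x → x ∈ R → x ∈ R') × (∀ x → x ∈ R' → x ∈ R)

worldsSeq : Seq → List World
worldsSeq s = concatMap (λ r → proj₁ r ∷ proj₂ r ∷ []) (rel s)
           ++ concatMap (λ f → proj₁ f ∷ []) (ant s)
           ++ concatMap (λ f → proj₁ f ∷ []) (sucd s)

propsSeq : Seq → List ℕ
propsSeq s = concatMap (λ f → props (proj₂ f)) (ant s)
          ++ concatMap (λ f → props (proj₂ f)) (sucd s)

-- The calculi.  Kt = ℓKt2, IKt = ℓIKt2, mIKt = mℓIKt2.

data Sys : Set where
  Kt IKt mIKt : Sys

SeqOK : Sys → Seq → Set
SeqOK IKt s = length (sucd s) ≡ 1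
SeqOK Kt   s = ⊤
SeqOK mIKt s = ⊤

RightOK : Sys → List LFm → Set
RightOK mIKt Δ = Δ ≡ []
RightOK Kt   Δ = ⊤
RightOK IKt  Δ = ⊤

-- Der S c s : s is derivable in system S; cut may be used only if c ≡ true.
-- Each constructor requires SeqOK S of its conclusion (premises are
-- conclusions of subderivations, so every sequent is checked).
-- The 'exch' rule identifies sequents whose relational part is the same set
-- and whose Γ, Δ are the same multisets.
data Der (S : Sys) (c : Bool) : Seq → Set where
  exch : ∀ {R R' Γ Γ' Δ Δ'} → SeqOK S ⟨ R' ∣ Γ' ⇒ Δ' ⟩ →
         SetEq R R' → Γ ↭ Γ' → Δ ↭ Δ' →
         Der S c ⟨ R ∣ Γ ⇒ Δ ⟩ → Der S c ⟨ R' ∣ Γ' ⇒ Δ' ⟩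
  id   : ∀ {R v A} → SeqOK S ⟨ R ∣ (v , A) ∷ [] ⇒ (v , A) ∷ [] ⟩ →
         Der S c ⟨ R ∣ (v , A) ∷ [] ⇒ (v , A) ∷ [] ⟩
  cut  : ∀ {R Γ Γ' Δ Δ' v A} → c ≡ true →
         SeqOK S ⟨ R ∣ Γ ++ Γ' ⇒ Δ ++ Δ' ⟩ →
         Der S c ⟨ R ∣ Γ ⇒ (v , A) ∷ Δ ⟩ →
         Der S c ⟨ R ∣ (v , A) ∷ Γ' ⇒ Δ' ⟩ →
         Der S c ⟨ R ∣ Γ ++ Γ' ⇒ Δ ++ Δ' ⟩
  wL   : ∀ {R Γ Δ x} → SeqOK S ⟨ R ∣ x ∷ Γ ⇒ Δ ⟩ →
         Der S c ⟨ R ∣ Γ ⇒ Δ ⟩ → Der S c ⟨ R ∣ x ∷ Γ ⇒ Δ ⟩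
  wR   : ∀ {R Γ Δ x} → SeqOK S ⟨ R ∣ Γ ⇒ x ∷ Δ ⟩ →
         Der S c ⟨ R ∣ Γ ⇒ Δ ⟩ → Der S c ⟨ R ∣ Γ ⇒ x ∷ Δ ⟩
  cL   : ∀ {R Γ Δ x} → SeqOK S ⟨ R ∣ x ∷ Γ ⇒ Δ ⟩ →
         Der S c ⟨ R ∣ x ∷ x ∷ Γ ⇒ Δ ⟩ → Der S c ⟨ R ∣ x ∷ Γ ⇒ Δ ⟩
  cR   : ∀ {R Γ Δ x} → SeqOK S ⟨ R ∣ Γ ⇒ x ∷ Δ ⟩ →
         Der S c ⟨ R ∣ Γ ⇒ x ∷ x ∷ Δ ⟩ → Der S c ⟨ R ∣ Γ ⇒ x ∷ Δ ⟩
  →L   : ∀ {R Γ Γ' Δ Δ' v A B} →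
         SeqOK S ⟨ R ∣ (v , A ⇒ B) ∷ Γ ++ Γ' ⇒ Δ ++ Δ' ⟩ →
         Der S c ⟨ R ∣ Γ ⇒ (v , A) ∷ Δ ⟩ →
         Der S c ⟨ R ∣ (v , B) ∷ Γ' ⇒ Δ' ⟩ →
         Der S c ⟨ R ∣ (v , A ⇒ B) ∷ Γ ++ Γ' ⇒ Δ ++ Δ' ⟩
  →R   : ∀ {R Γ Δ v A B} → RightOK S Δ →
         SeqOK S ⟨ R ∣ Γ ⇒ (v , A ⇒ B) ∷ Δ ⟩ →
         Der S c ⟨ R ∣ (v , A) ∷ Γ ⇒ (v , B) ∷ Δ ⟩ →
         Der S c ⟨ R ∣ Γ ⇒ (v , A ⇒ B) ∷ Δ ⟩
  ∀L   : ∀ {R Γ Δ v A C} →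
         SeqOK S ⟨ R ∣ (v , ∀' A) ∷ Γ ⇒ Δ ⟩ →
         Der S c ⟨ R ∣ (v , A [ C ]) ∷ Γ ⇒ Δ ⟩ →
         Der S c ⟨ R ∣ (v , ∀' A) ∷ Γ ⇒ Δ ⟩
  ∀R   : ∀ {R Γ Δ v A} (P : ℕ) → RightOK S Δ →
         P ∉ propsSeq ⟨ R ∣ Γ ⇒ (v , ∀' A) ∷ Δ ⟩ →
         SeqOK S ⟨ R ∣ Γ ⇒ (v , ∀' A) ∷ Δ ⟩ →
         Der S c ⟨ R ∣ Γ ⇒ (v , A [ prop P ]) ∷ Δ ⟩ →
         Der S c ⟨ R ∣ Γ ⇒ (v , ∀' A) ∷ Δ ⟩
  □L   : ∀ {R Γ Δ v w A} →
         SeqOK S ⟨ (v , w) ∷ R ∣ (v , □ A) ∷ Γ ⇒ Δ ⟩ →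
         Der S c ⟨ (v , w) ∷ R ∣ (w , A) ∷ Γ ⇒ Δ ⟩ →
         Der S c ⟨ (v , w) ∷ R ∣ (v , □ A) ∷ Γ ⇒ Δ ⟩
  □R   : ∀ {R Γ Δ v A} (w : World) → RightOK S Δ →
         w ∉ worldsSeq ⟨ R ∣ Γ ⇒ (v , □ A) ∷ Δ ⟩ →
         SeqOK S ⟨ R ∣ Γ ⇒ (v , □ A) ∷ Δ ⟩ →
         Der S c ⟨ (v , w) ∷ R ∣ Γ ⇒ (w , A) ∷ Δ ⟩ →
         Der S c ⟨ R ∣ Γ ⇒ (v , □ A) ∷ Δ ⟩
  ■L   : ∀ {R Γ Δ u v A} →
         SeqOK S ⟨ (u , v) ∷ R ∣ (v , ■ A) ∷ Γ ⇒ Δ ⟩ →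
         Der S c ⟨ (u , v) ∷ R ∣ (u , A) ∷ Γ ⇒ Δ ⟩ →
         Der S c ⟨ (u , v) ∷ R ∣ (v , ■ A) ∷ Γ ⇒ Δ ⟩
  ■R   : ∀ {R Γ Δ v A} (u : World) → RightOK S Δ →
         u ∉ worldsSeq ⟨ R ∣ Γ ⇒ (v , ■ A) ∷ Δ ⟩ →
         SeqOK S ⟨ R ∣ Γ ⇒ (v , ■ A) ∷ Δ ⟩ →
         Der S c ⟨ (u , v) ∷ R ∣ Γ ⇒ (u , A) ∷ Δ ⟩ →
         Der S c ⟨ R ∣ Γ ⇒ (v , ■ A) ∷ Δ ⟩

-- L ⊢ A : L proves ∅ | ∅ ⇒ v : A   (c = true: with cut; c = false: L \ cut)
_,_⊢_at_ : Sys → Bool → Fm 0 → World → Set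
S , c ⊢ A at v = Der S c ⟨ [] ∣ [] ⇒ (v , A) ∷ [] ⟩

-- In an mℓIKt2 derivation every right logical rule has an empty context Δ,
-- so the succedent formulas other than one distinguished formula are only
-- carried along by weakening, contraction and the side contexts of cut and
-- →L. By induction on the derivation, every derivable R ∣ Γ ⇒ Δ therefore has
-- a formula x ∈ Δ with R ∣ Γ ⇒ x derivable in ℓIKt2; when the distinguished
-- formula of the left premise of cut or →L is not the principal one, the
-- conclusion follows from that premise by left weakening. The translation uses
-- cut only where the given derivation does, so it also preserves cut-freeness.
module Submission where

open import Defs
open import Data.Bool using (Bool; true; false)
open import Data.Product using (_×_; _,_)
open import Data.List using ([]; _∷_; _++_)
open import Data.List.Membership.Propositional using (_∈_)
open import Data.List.Relation.Unary.Any using (here; there)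
open import Data.List.Membership.Propositional.Properties using (∈-++⁺ˡ; ∈-++⁺ʳ)
open import Data.List.Relation.Binary.Permutation.Propositional using (↭-refl)
open import Data.List.Relation.Binary.Permutation.Propositional.Properties
  using (∈-resp-↭; ++-comm)
open import Relation.Binary.PropositionalEquality using (refl)

SetEq-refl : ∀ R → SetEq R R
SetEq-refl R = (λ _ x∈R → x∈R) , (λ _ x∈R → x∈R)

weakenˡ-++ : ∀ {c R Γ x} Θ →
             Der IKt c ⟨ R ∣ Γ ⇒ x ∷ [] ⟩ → Der IKt c ⟨ R ∣ Θ ++ Γ ⇒ x ∷ [] ⟩
weakenˡ-++ []      d = d
weakenˡ-++ (_ ∷ Θ) d = wL refl (weakenˡ-++ Θ d)

weakenʳ-++ : ∀ {c R Γ x} Θ →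
             Der IKt c ⟨ R ∣ Γ ⇒ x ∷ [] ⟩ → Der IKt c ⟨ R ∣ Γ ++ Θ ⇒ x ∷ [] ⟩
weakenʳ-++ {Γ = Γ} Θ d =
  exch refl (SetEq-refl _) (++-comm Θ Γ) ↭-refl (weakenˡ-++ Θ d)

∈-contract : ∀ {A : Set} {x y : A} {xs} → x ∈ y ∷ y ∷ xs → x ∈ y ∷ xs
∈-contract (here x≡y) = here x≡y
∈-contract (there x∈) = x∈

record SingleConclusion (c : Bool) (s : Seq) : Set where
  constructor witness
  field
    conclusion  : LFm
    conclusion∈ : conclusion ∈ sucd s
    derivation  : Der IKt c ⟨ rel s ∣ ant s ⇒ conclusion ∷ [] ⟩

mIKt⇒SingleConclusion : ∀ {c s} → Der mIKt c s → SingleConclusion c s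
mIKt⇒SingleConclusion (exch _ R≈R' Γ↭Γ' Δ↭Δ' d) with mIKt⇒SingleConclusion d
... | witness x x∈ d' = witness x (∈-resp-↭ Δ↭Δ' x∈) (exch refl R≈R' Γ↭Γ' ↭-refl d')
mIKt⇒SingleConclusion (id _) = witness _ (here refl) (id refl)
mIKt⇒SingleConclusion (cut {Γ' = Γ'} {Δ} c≡true _ d₁ d₂)
  with mIKt⇒SingleConclusion d₁ | mIKt⇒SingleConclusion d₂
... | witness _ (here refl) d₁' | witness y y∈ d₂' =
  witness y (∈-++⁺ʳ Δ y∈) (cut c≡true refl d₁' d₂')
... | witness x (there x∈) d₁' | _ = witness x (∈-++⁺ˡ x∈) (weakenʳ-++ Γ' d₁')
mIKt⇒SingleConclusion (→L {Γ' = Γ'} {Δ} _ d₁ d₂)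
  with mIKt⇒SingleConclusion d₁ | mIKt⇒SingleConclusion d₂
... | witness _ (here refl) d₁' | witness y y∈ d₂' =
  witness y (∈-++⁺ʳ Δ y∈) (→L refl d₁' d₂')
... | witness x (there x∈) d₁' | _ = witness x (∈-++⁺ˡ x∈) (wL refl (weakenʳ-++ Γ' d₁'))
mIKt⇒SingleConclusion (wL _ d) with mIKt⇒SingleConclusion d
... | witness x x∈ d' = witness x x∈ (wL refl d')
mIKt⇒SingleConclusion (wR _ d) with mIKt⇒SingleConclusion d
... | witness x x∈ d' = witness x (there x∈) d'
mIKt⇒SingleConclusion (cL _ d) with mIKt⇒SingleConclusion d
... | witness x x∈ d' = witness x x∈ (cL refl d')
mIKt⇒SingleConclusion (cR _ d) with mIKt⇒SingleConclusion d
... | witness x x∈ d' = witness x (∈-contract x∈) d'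
mIKt⇒SingleConclusion (∀L _ d) with mIKt⇒SingleConclusion d
... | witness x x∈ d' = witness x x∈ (∀L refl d')
mIKt⇒SingleConclusion (□L _ d) with mIKt⇒SingleConclusion d
... | witness x x∈ d' = witness x x∈ (□L refl d')
mIKt⇒SingleConclusion (■L _ d) with mIKt⇒SingleConclusion d
... | witness x x∈ d' = witness x x∈ (■L refl d')
mIKt⇒SingleConclusion (→R refl _ d) with mIKt⇒SingleConclusion d
... | witness _ (here refl) d' = witness _ (here refl) (→R _ refl d')
mIKt⇒SingleConclusion (∀R P refl P-fresh _ d) with mIKt⇒SingleConclusion d
... | witness _ (here refl) d' = witness _ (here refl) (∀R P _ P-fresh refl d')
mIKt⇒SingleConclusion (□R w refl w-fresh _ d) with mIKt⇒SingleConclusion d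
... | witness _ (here refl) d' = witness _ (here refl) (□R w _ w-fresh refl d')
mIKt⇒SingleConclusion (■R u refl u-fresh _ d) with mIKt⇒SingleConclusion d
... | witness _ (here refl) d' = witness _ (here refl) (■R u _ u-fresh refl d')

mIKt⇒IKt : ∀ {c R Γ x} →
           Der mIKt c ⟨ R ∣ Γ ⇒ x ∷ [] ⟩ → Der IKt c ⟨ R ∣ Γ ⇒ x ∷ [] ⟩
mIKt⇒IKt d with mIKt⇒SingleConclusion d
... | witness _ (here refl) d' = d'

proposition4p4 : ∀ (A : Fm 0) (v : World) →
    ((mIKt , true ⊢ A at v) → (IKt , true ⊢ A at v)) ×
    ((mIKt , false ⊢ A at v) → (IKt , false ⊢ A at v))
proposition4p4 A v = mIKt⇒IKt , mIKt⇒IKt
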